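{- Let $m\in\mathbb{Z}^+$ and $i_1,\dots,i_m\in\mathbb{N}$. There exist integers $A_{i_{1},\ldots,i_{m}}^{(\ell)}$ ($0\le\ell\le i_1+\cdots+i_m$), independent of $k$, such that for all $k\in\mathbb{N}$ \[ \prod_{j=1}^{m}\frac{1}{i_{j}+1}\binom{k+i_{j}}{2i_{j}}\binom{2i_{j}}{i_{j}}=\sum_{\ell=0}^{i_{1}+\cdots+i_{m}}A_{i_{1},\ldots,i_{m}}^{(\ell)}\frac{1}{\ell+1}\binom{k+\ell}{2\ell}\binom{2\ell}{\ell}, \] and $A_{i'_{1},\ldots,i'_{m}}^{(\ell)}=A_{i_{1},\ldots,i_{m}}^{(\ell)}$ whenever $(i'_{1},\dots,i'_{m})$ is a permutation of $(i_{1},\dots,i_{m})$. -}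

module Defs where

open import Data.Nat using (ℕ; zero; suc; _+_; _*_; _/_)
open import Data.Nat.Combinatorics using (_C_)
open import Data.Integer using (ℤ; +_) renaming (_+_ to _+ℤ_; _*_ to _*ℤ_)
open import Data.Vec using (Vec; []; _∷_)

-- T k i = (1/(i+1)) * C(k+i, 2i) * C(2i, i).
-- The division is exact: C(2i,i)/(i+1) is the i-th Catalan number.
T : ℕ → ℕ → ℕ
T k i = (((k + i) C (2 * i)) * ((2 * i) C i)) / suc i

prodT : ∀ {m} → ℕ → Vec ℕ m → ℕ
prodT k []       = 1
prodT k (i ∷ is) = T k i * prodT k is

vsum : ∀ {m} → Vec ℕ m → ℕ
vsum []       = 0
vsum (i ∷ is) = i + vsum is

Σ≤ : ℕ → (ℕ → ℤ) → ℤ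
Σ≤ zero    f = f 0
Σ≤ (suc n) f = Σ≤ n f +ℤ f (suc n)

module Submission where

-- With U_ℓ(k) = (ℓ+1)·T_ℓ(k) = C(k+ℓ,2ℓ)·C(2ℓ,ℓ) one has (ℓ+1)²·U_{ℓ+1} = (k(k+1) − ℓ(ℓ+1))·U_ℓ,
-- so U_ℓ is a polynomial of degree ℓ in k(k+1). Induction on b with this recurrence gives
-- U_a·U_b = Σ_ℓ C(a+b,ℓ)·C(ℓ,a)·C(ℓ,b)·U_ℓ, and dividing by (a+1)(b+1) turns it into
-- T_a·T_b = Σ_ℓ c(a,b,ℓ)·T_ℓ for an explicit integer c(a,b,ℓ). Expanding the product one factor
-- at a time yields integer coefficients A, which do not depend on the order of the factors because
-- the expansion is unique: T_ℓ(k) = 0 for k < ℓ while T_ℓ(ℓ) ≠ 0.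

open import Defs
open import Data.Nat as ℕ using (ℕ; zero; suc; _≤_; _<_; z≤n; s≤s)
import Data.Nat.Properties as ℕₚ
open import Data.Nat.Combinatorics using (_C_; nCn≡1; nC1≡n; k>n⇒nCk≡0; nCk+nC[k+1]≡[n+1]C[k+1])
open import Data.Nat.Divisibility using (_∣_; divides; ∣m+n∣m⇒∣n; ∣n⇒∣m*n)
open import Data.Nat.DivMod using (m/n*n≡m)
open import Data.Nat.Induction using (<-rec)
open import Data.Nat.ListAction using (sum; product)
open import Data.Nat.ListAction.Properties using (sum-↭; product-↭)
import Data.Nat.Tactic.RingSolver as ℕ-Solver
open import Data.Integer using (ℤ; +_; _+_; _*_; _-_; -_; 0ℤ; 1ℤ; -1ℤ)
open import Data.Integer using () renaming (_*_ to _*ℤ_)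
import Data.Integer.Properties as ℤₚ
open import Data.Integer.Tactic.RingSolver using (solve)
open import Data.List using ([]; _∷_; map)
open import Data.List.Relation.Binary.Permutation.Propositional using (_↭_)
import Data.List.Relation.Binary.Permutation.Propositional.Properties as ↭
open import Data.Vec using (Vec; toList)
open import Data.Product using (∃; _×_; _,_)
open import Data.Sum using (inj₁; inj₂)
open import Relation.Binary.Definitions using (tri<; tri≈; tri>)
open import Relation.Nullary using (contradiction)
open import Relation.Binary.PropositionalEquality
open import Algebra.Properties.CommutativeSemigroup ℤₚ.+-commutativeSemigroup using (interchange)
open import Algebra.Properties.CommutativeSemigroup ℤₚ.*-commutativeSemigroup
  using (x∙yz≈y∙xz) renaming (interchange to *-interchange)
open ≡-Reasoning

Σ≤-cong : ∀ n {f g : ℕ → ℤ} → (∀ ℓ → ℓ ≤ n → f ℓ ≡ g ℓ) → Σ≤ n f ≡ Σ≤ n g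
Σ≤-cong zero    f≗g = f≗g 0 z≤n
Σ≤-cong (suc n) f≗g =
  cong₂ _+_ (Σ≤-cong n λ ℓ ℓ≤n → f≗g ℓ (ℕₚ.m≤n⇒m≤1+n ℓ≤n)) (f≗g (suc n) ℕₚ.≤-refl)

Σ≤-zero : ∀ n {f : ℕ → ℤ} → (∀ ℓ → ℓ ≤ n → f ℓ ≡ 0ℤ) → Σ≤ n f ≡ 0ℤ
Σ≤-zero zero    f≗0 = f≗0 0 z≤n
Σ≤-zero (suc n) f≗0 =
  cong₂ _+_ (Σ≤-zero n λ ℓ ℓ≤n → f≗0 ℓ (ℕₚ.m≤n⇒m≤1+n ℓ≤n)) (f≗0 (suc n) ℕₚ.≤-refl)

Σ≤-distrib-+ : ∀ n (f g : ℕ → ℤ) → Σ≤ n (λ ℓ → f ℓ + g ℓ) ≡ Σ≤ n f + Σ≤ n g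
Σ≤-distrib-+ zero    f g = refl
Σ≤-distrib-+ (suc n) f g = trans (cong (_+ (f (suc n) + g (suc n))) (Σ≤-distrib-+ n f g))
                                 (interchange (Σ≤ n f) (Σ≤ n g) (f (suc n)) (g (suc n)))

Σ≤-*ˡ : ∀ n c (f : ℕ → ℤ) → Σ≤ n (λ ℓ → c * f ℓ) ≡ c * Σ≤ n f
Σ≤-*ˡ zero    c f = refl
Σ≤-*ˡ (suc n) c f = trans (cong (_+ c * f (suc n)) (Σ≤-*ˡ n c f)) (sym (ℤₚ.*-distribˡ-+ c (Σ≤ n f) (f (suc n))))

Σ≤-*ʳ : ∀ n c (f : ℕ → ℤ) → Σ≤ n (λ ℓ → f ℓ * c) ≡ Σ≤ n f * c
Σ≤-*ʳ zero    c f = refl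
Σ≤-*ʳ (suc n) c f = trans (cong (_+ f (suc n) * c) (Σ≤-*ʳ n c f)) (sym (ℤₚ.*-distribʳ-+ c (Σ≤ n f) (f (suc n))))

Σ≤-distrib-- : ∀ n (f g : ℕ → ℤ) → Σ≤ n (λ ℓ → f ℓ - g ℓ) ≡ Σ≤ n f - Σ≤ n g
Σ≤-distrib-- n f g = begin
  Σ≤ n (λ ℓ → f ℓ - g ℓ)          ≡⟨ Σ≤-cong n (λ ℓ _ → cong (λ x → f ℓ + x) (sym (ℤₚ.-1*i≡-i (g ℓ)))) ⟩
  Σ≤ n (λ ℓ → f ℓ + -1ℤ * g ℓ)    ≡⟨ Σ≤-distrib-+ n f _ ⟩
  Σ≤ n f + Σ≤ n (λ ℓ → -1ℤ * g ℓ) ≡⟨ cong (λ x → Σ≤ n f + x) (trans (Σ≤-*ˡ n -1ℤ g) (ℤₚ.-1*i≡-i _)) ⟩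
  Σ≤ n f - Σ≤ n g                 ∎

Σ≤-shift : ∀ n {f : ℕ → ℤ} → f 0 ≡ 0ℤ → Σ≤ (suc n) f ≡ Σ≤ n (λ ℓ → f (suc ℓ))
Σ≤-shift zero    {f} f₀≡0 = trans (cong (_+ f 1) f₀≡0) (ℤₚ.+-identityˡ (f 1))
Σ≤-shift (suc n) {f} f₀≡0 = cong (_+ f (suc (suc n))) (Σ≤-shift n f₀≡0)

Σ≤-extend : ∀ {n} N {f : ℕ → ℤ} → n ≤ N → (∀ ℓ → n < ℓ → ℓ ≤ N → f ℓ ≡ 0ℤ) → Σ≤ N f ≡ Σ≤ n f
Σ≤-extend N n≤N f≗0 with ℕₚ.m≤n⇒m<n∨m≡n n≤N
... | inj₂ refl = refl
Σ≤-extend (suc N) _ f≗0 | inj₁ (s≤s n≤N) =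
  trans (cong₂ _+_ (Σ≤-extend N n≤N λ ℓ n<ℓ ℓ≤N → f≗0 ℓ n<ℓ (ℕₚ.m≤n⇒m≤1+n ℓ≤N))
                   (f≗0 (suc N) (s≤s n≤N) ℕₚ.≤-refl))
        (ℤₚ.+-identityʳ _)

Σ≤-single : ∀ {n} ℓ {f : ℕ → ℤ} → ℓ ≤ n → (∀ j → j ≤ n → j ≢ ℓ → f j ≡ 0ℤ) → Σ≤ n f ≡ f ℓ
Σ≤-single {n} ℓ {f} ℓ≤n f≗0 =
  trans (Σ≤-extend n ℓ≤n λ j ℓ<j j≤n → f≗0 j j≤n (ℕₚ.>⇒≢ ℓ<j))
        (Σ≤-last ℓ λ j j<ℓ → f≗0 j (ℕₚ.<⇒≤ (ℕₚ.<-≤-trans j<ℓ ℓ≤n)) (ℕₚ.<⇒≢ j<ℓ))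
  where
  Σ≤-last : ∀ ℓ → (∀ j → j < ℓ → f j ≡ 0ℤ) → Σ≤ ℓ f ≡ f ℓ
  Σ≤-last zero    _   = refl
  Σ≤-last (suc ℓ) f≗0 =
    trans (cong (_+ f (suc ℓ)) (Σ≤-zero ℓ λ j j≤ℓ → f≗0 j (s≤s j≤ℓ))) (ℤₚ.+-identityˡ _)

Σ≤-comm : ∀ m n (f : ℕ → ℕ → ℤ) → Σ≤ m (λ i → Σ≤ n (f i)) ≡ Σ≤ n (λ j → Σ≤ m (λ i → f i j))
Σ≤-comm zero    n f = refl
Σ≤-comm (suc m) n f = trans (cong (_+ Σ≤ n (f (suc m))) (Σ≤-comm m n f))
                            (sym (Σ≤-distrib-+ n _ (f (suc m))))

[n+1]C[k+1]*[k+1]≡[n+1]*nCk : ∀ n k → (suc n C suc k) ℕ.* suc k ≡ suc n ℕ.* (n C k)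
[n+1]C[k+1]*[k+1]≡[n+1]*nCk zero    zero    = refl
[n+1]C[k+1]*[k+1]≡[n+1]*nCk zero    (suc k) = refl
[n+1]C[k+1]*[k+1]≡[n+1]*nCk (suc n) zero    =
  cong (ℕ._* 1) (nC1≡n (suc (suc n)))
[n+1]C[k+1]*[k+1]≡[n+1]*nCk (suc n) (suc k) =
  trans (cong (ℕ._* suc (suc k)) (sym (nCk+nC[k+1]≡[n+1]C[k+1] (suc n) (suc k))))
        (pascal-step n k (n C k) (n C suc k) (suc n C suc (suc k)) (nCk+nC[k+1]≡[n+1]C[k+1] n k)
                     ([n+1]C[k+1]*[k+1]≡[n+1]*nCk n k) ([n+1]C[k+1]*[k+1]≡[n+1]*nCk n (suc k)))
  where
  pascal-step : ∀ n k {x} c₀ c₁ y → c₀ ℕ.+ c₁ ≡ x →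
                x ℕ.* suc k ≡ suc n ℕ.* c₀ → y ℕ.* suc (suc k) ≡ suc n ℕ.* c₁ →
                (x ℕ.+ y) ℕ.* suc (suc k) ≡ suc (suc n) ℕ.* x
  pascal-step n k c₀ c₁ y refl h₀ h₁ = begin
    (c₀ ℕ.+ c₁ ℕ.+ y) ℕ.* suc (suc k)
      ≡⟨ ℕ-Solver.solve (c₀ ∷ c₁ ∷ y ∷ k ∷ []) ⟩
    (c₀ ℕ.+ c₁) ℕ.* suc k ℕ.+ (c₀ ℕ.+ c₁) ℕ.+ y ℕ.* suc (suc k)
      ≡⟨ cong₂ (λ u v → u ℕ.+ (c₀ ℕ.+ c₁) ℕ.+ v) h₀ h₁ ⟩
    suc n ℕ.* c₀ ℕ.+ (c₀ ℕ.+ c₁) ℕ.+ suc n ℕ.* c₁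
      ≡⟨ ℕ-Solver.solve (c₀ ∷ c₁ ∷ n ∷ []) ⟩
    suc (suc n) ℕ.* (c₀ ℕ.+ c₁) ∎

k≤n⇒nCk>0 : ∀ {n k} → k ≤ n → 0 < n C k
k≤n⇒nCk>0 {n}     {zero}  _         = s≤s z≤n
k≤n⇒nCk>0 {suc n} {suc k} (s≤s k≤n) =
  subst (0 <_) (nCk+nC[k+1]≡[n+1]C[k+1] n k) (ℕₚ.<-≤-trans (k≤n⇒nCk>0 k≤n) (ℕₚ.m≤m+n _ _))

-- n+1 divides both 2(n+1)·C(2n,n) and (2n+1)·C(2n,n) = C(2n+1,n+1)·(n+1), hence their difference.
[n+1]∣[2n]Cn : ∀ n → suc n ∣ (2 ℕ.* n) C n
[n+1]∣[2n]Cn n = ∣m+n∣m⇒∣n (divides (2 ℕ.* x) (double n x))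
                           (divides (suc (2 ℕ.* n) C suc n) (sym ([n+1]C[k+1]*[k+1]≡[n+1]*nCk (2 ℕ.* n) n)))
  where
  x = (2 ℕ.* n) C n
  double : ∀ n x → suc (2 ℕ.* n) ℕ.* x ℕ.+ x ≡ 2 ℕ.* x ℕ.* suc n
  double n x = ℕ-Solver.solve (n ∷ x ∷ [])

2*n≡n+n : ∀ n → 2 ℕ.* n ≡ n ℕ.+ n
2*n≡n+n n = cong (n ℕ.+_) (ℕₚ.+-identityʳ n)

[ℓ+1]*T≡[k+ℓ]C[2ℓ]*[2ℓ]Cℓ : ∀ k ℓ → suc ℓ ℕ.* T k ℓ ≡ ((k ℕ.+ ℓ) C (2 ℕ.* ℓ)) ℕ.* ((2 ℕ.* ℓ) C ℓ)
[ℓ+1]*T≡[k+ℓ]C[2ℓ]*[2ℓ]Cℓ k ℓ =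
  trans (ℕₚ.*-comm (suc ℓ) (T k ℓ)) (m/n*n≡m (∣n⇒∣m*n ((k ℕ.+ ℓ) C (2 ℕ.* ℓ)) ([n+1]∣[2n]Cn ℓ)))

T-vanishes : ∀ {k ℓ} → k < ℓ → T k ℓ ≡ 0
T-vanishes {k} {ℓ} k<ℓ =
  cong (λ c → c ℕ.* ((2 ℕ.* ℓ) C ℓ) ℕ./ suc ℓ)
       (k>n⇒nCk≡0 (subst (k ℕ.+ ℓ <_) (sym (2*n≡n+n ℓ)) (ℕₚ.+-monoˡ-< ℓ k<ℓ)))

T-diagonal≢0 : ∀ ℓ → T ℓ ℓ ≢ 0
T-diagonal≢0 ℓ Tℓℓ≡0 = ℕₚ.<⇒≢ (k≤n⇒nCk>0 (ℕₚ.m≤m+n ℓ (ℓ ℕ.+ 0))) (sym (begin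
  (2 ℕ.* ℓ) C ℓ                                        ≡⟨ sym (ℕₚ.*-identityˡ _) ⟩
  1 ℕ.* ((2 ℕ.* ℓ) C ℓ)                                ≡⟨ cong (ℕ._* ((2 ℕ.* ℓ) C ℓ)) [ℓ+ℓ]C[2ℓ]≡1 ⟨
  ((ℓ ℕ.+ ℓ) C (2 ℕ.* ℓ)) ℕ.* ((2 ℕ.* ℓ) C ℓ)          ≡⟨ [ℓ+1]*T≡[k+ℓ]C[2ℓ]*[2ℓ]Cℓ ℓ ℓ ⟨
  suc ℓ ℕ.* T ℓ ℓ                                      ≡⟨ cong (suc ℓ ℕ.*_) Tℓℓ≡0 ⟩
  suc ℓ ℕ.* 0                                          ≡⟨ ℕₚ.*-zeroʳ (suc ℓ) ⟩
  0                                                    ∎))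
  where
  [ℓ+ℓ]C[2ℓ]≡1 : (ℓ ℕ.+ ℓ) C (2 ℕ.* ℓ) ≡ 1
  [ℓ+ℓ]C[2ℓ]≡1 = trans (cong (_C (2 ℕ.* ℓ)) (sym (2*n≡n+n ℓ))) (nCn≡1 (2 ℕ.* ℓ))

binom : ℕ → ℕ → ℤ
binom n k = + (n C k)

binom-vanishes : ∀ {n k} → n < k → binom n k ≡ 0ℤ
binom-vanishes n<k = cong +_ (k>n⇒nCk≡0 n<k)

binom-diagonal : ∀ n → binom n n ≡ 1ℤ
binom-diagonal n = cong +_ (nCn≡1 n)

binom-pascal : ∀ n k → binom n k + binom n (suc k) ≡ binom (suc n) (suc k)
binom-pascal n k = trans (sym (ℤₚ.pos-+ (n C k) _)) (cong +_ (nCk+nC[k+1]≡[n+1]C[k+1] n k))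

binom-absorb : ∀ n k → binom (suc n) (suc k) * + suc k ≡ + suc n * binom n k
binom-absorb n k = trans (sym (ℤₚ.pos-* (suc n C suc k) (suc k)))
                         (trans (cong +_ ([n+1]C[k+1]*[k+1]≡[n+1]*nCk n k)) (ℤₚ.pos-* (suc n) (n C k)))

-- The helpers below are stated over ring variables and applied to + n, + k, binom n k, …;
-- instances such as 1ℤ + + k and + suc k agree definitionally.
binom-sucʳ : ∀ n k → binom n (suc k) * + suc k ≡ binom n k * (+ n - + k)
binom-sucʳ n k = via-pascal (binom n k) (binom n (suc k)) (+ n) (+ k)
  (trans (cong (_* + suc k) (binom-pascal n k)) (binom-absorb n k))
  where
  via-pascal : ∀ x y n k → (x + y) * (1ℤ + k) ≡ (1ℤ + n) * x → y * (1ℤ + k) ≡ x * (n - k)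
  via-pascal x y n k h = begin
    y * (1ℤ + k)                       ≡⟨ solve (x ∷ y ∷ k ∷ []) ⟩
    (x + y) * (1ℤ + k) - x * (1ℤ + k)  ≡⟨ cong (_- x * (1ℤ + k)) h ⟩
    (1ℤ + n) * x - x * (1ℤ + k)        ≡⟨ solve (x ∷ n ∷ k ∷ []) ⟩
    x * (n - k)                        ∎

binom-sucˡ : ∀ n k → binom (suc n) k * (+ suc n - + k) ≡ + suc n * binom n k
binom-sucˡ n zero    = ring (+ suc n)
  where
  ring : ∀ m → 1ℤ * (m - 0ℤ) ≡ m * 1ℤ
  ring m = solve (m ∷ [])
binom-sucˡ n (suc k) = via-pascal (binom n k) (binom n (suc k)) (+ n) (+ k)
  (binom-pascal n k) (binom-absorb n k)
  where
  via-pascal : ∀ {z} x y n k → x + y ≡ z → z * (1ℤ + k) ≡ (1ℤ + n) * x →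
               z * (1ℤ + n - (1ℤ + k)) ≡ (1ℤ + n) * y
  via-pascal x y n k refl h = begin
    (x + y) * (1ℤ + n - (1ℤ + k))               ≡⟨ solve (x ∷ y ∷ n ∷ k ∷ []) ⟩
    (x + y) * (1ℤ + n) - (x + y) * (1ℤ + k)     ≡⟨ cong (λ w → (x + y) * (1ℤ + n) - w) h ⟩
    (x + y) * (1ℤ + n) - (1ℤ + n) * x           ≡⟨ solve (x ∷ y ∷ n ∷ []) ⟩
    (1ℤ + n) * y                                ∎

pronic : ℤ → ℤ
pronic x = x * (x + 1ℤ)

-- Indexed by ℓ + ℓ rather than 2 * ℓ so that + (ℓ + ℓ) is definitionally + ℓ + + ℓ.
U : ℕ → ℕ → ℤ
U k ℓ = binom (k ℕ.+ ℓ) (ℓ ℕ.+ ℓ) * binom (ℓ ℕ.+ ℓ) ℓ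

U≡[1+ℓ]*T : ∀ k ℓ → U k ℓ ≡ + suc ℓ * + T k ℓ
U≡[1+ℓ]*T k ℓ = begin
  + ((k ℕ.+ ℓ) C (ℓ ℕ.+ ℓ)) * + ((ℓ ℕ.+ ℓ) C ℓ)
    ≡⟨ ℤₚ.pos-* ((k ℕ.+ ℓ) C (ℓ ℕ.+ ℓ)) ((ℓ ℕ.+ ℓ) C ℓ) ⟨
  + (((k ℕ.+ ℓ) C (ℓ ℕ.+ ℓ)) ℕ.* ((ℓ ℕ.+ ℓ) C ℓ))
    ≡⟨ cong (λ m → + (((k ℕ.+ ℓ) C m) ℕ.* (m C ℓ))) (2*n≡n+n ℓ) ⟨
  + (((k ℕ.+ ℓ) C (2 ℕ.* ℓ)) ℕ.* ((2 ℕ.* ℓ) C ℓ))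
    ≡⟨ cong +_ ([ℓ+1]*T≡[k+ℓ]C[2ℓ]*[2ℓ]Cℓ k ℓ) ⟨
  + (suc ℓ ℕ.* T k ℓ)
    ≡⟨ ℤₚ.pos-* (suc ℓ) (T k ℓ) ⟩
  + suc ℓ * + T k ℓ ∎

U-rec : ∀ k ℓ → + suc ℓ * + suc ℓ * U k (suc ℓ) ≡ (pronic (+ k) - pronic (+ ℓ)) * U k ℓ
U-rec k ℓ = ℤₚ.*-cancelˡ-≡ (+ suc m * + suc (suc m)) _ _ (begin
  + suc m * + suc (suc m) * (+ suc ℓ * + suc ℓ * U k (suc ℓ))
    ≡⟨ cong (λ u → + suc m * + suc (suc m) * (+ suc ℓ * + suc ℓ * u)) U-suc ⟩
  + suc m * + suc (suc m) * (+ suc ℓ * + suc ℓ * (binom (suc n) (suc (suc m)) * binom (suc (suc m)) (suc ℓ)))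
    ≡⟨ cleared (+ k) (+ ℓ) (binom (suc n) (suc (suc m))) (binom (suc (suc m)) (suc ℓ))
            (binom n (suc m)) (binom (suc m) ℓ) (binom n m) (binom m ℓ)
            (binom-absorb n (suc m)) (binom-sucʳ n m) (binom-absorb (suc m) ℓ) (binom-sucˡ m ℓ) ⟩
  + suc m * + suc (suc m) * ((pronic (+ k) - pronic (+ ℓ)) * U k ℓ) ∎)
  where
  n = k ℕ.+ ℓ
  m = ℓ ℕ.+ ℓ
  U-suc : U k (suc ℓ) ≡ binom (suc n) (suc (suc m)) * binom (suc (suc m)) (suc ℓ)
  U-suc = cong₂ (λ a b → binom a b * binom b (suc ℓ)) (ℕₚ.+-suc k ℓ) (cong suc (ℕₚ.+-suc ℓ ℓ))
  cleared : ∀ k ℓ P Q R S W V →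
            P * (1ℤ + (1ℤ + (ℓ + ℓ))) ≡ (1ℤ + (k + ℓ)) * R →
            R * (1ℤ + (ℓ + ℓ)) ≡ W * (k + ℓ - (ℓ + ℓ)) →
            Q * (1ℤ + ℓ) ≡ (1ℤ + (1ℤ + (ℓ + ℓ))) * S →
            S * (1ℤ + (ℓ + ℓ) - ℓ) ≡ (1ℤ + (ℓ + ℓ)) * V →
            (1ℤ + (ℓ + ℓ)) * (1ℤ + (1ℤ + (ℓ + ℓ))) * ((1ℤ + ℓ) * (1ℤ + ℓ) * (P * Q))
              ≡ (1ℤ + (ℓ + ℓ)) * (1ℤ + (1ℤ + (ℓ + ℓ))) * ((k * (k + 1ℤ) - ℓ * (ℓ + 1ℤ)) * (W * V))
  cleared k ℓ P Q R S W V hP hR hQ hS = begin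
    (1ℤ + (ℓ + ℓ)) * (1ℤ + (1ℤ + (ℓ + ℓ))) * ((1ℤ + ℓ) * (1ℤ + ℓ) * (P * Q))
      ≡⟨ solve (ℓ ∷ P ∷ Q ∷ []) ⟩
    (1ℤ + ℓ) * (1ℤ + (ℓ + ℓ)) * (P * (1ℤ + (1ℤ + (ℓ + ℓ)))) * (Q * (1ℤ + ℓ))
      ≡⟨ cong₂ (λ p q → (1ℤ + ℓ) * (1ℤ + (ℓ + ℓ)) * p * q) hP hQ ⟩
    (1ℤ + ℓ) * (1ℤ + (ℓ + ℓ)) * ((1ℤ + (k + ℓ)) * R) * ((1ℤ + (1ℤ + (ℓ + ℓ))) * S)
      ≡⟨ solve (k ∷ ℓ ∷ R ∷ S ∷ []) ⟩
    (1ℤ + (k + ℓ)) * (1ℤ + (1ℤ + (ℓ + ℓ))) * (R * (1ℤ + (ℓ + ℓ))) * (S * (1ℤ + (ℓ + ℓ) - ℓ))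
      ≡⟨ cong₂ (λ r s → (1ℤ + (k + ℓ)) * (1ℤ + (1ℤ + (ℓ + ℓ))) * r * s) hR hS ⟩
    (1ℤ + (k + ℓ)) * (1ℤ + (1ℤ + (ℓ + ℓ))) * (W * (k + ℓ - (ℓ + ℓ))) * ((1ℤ + (ℓ + ℓ)) * V)
      ≡⟨ solve (k ∷ ℓ ∷ W ∷ V ∷ []) ⟩
    (1ℤ + (ℓ + ℓ)) * (1ℤ + (1ℤ + (ℓ + ℓ))) * ((k * (k + 1ℤ) - ℓ * (ℓ + 1ℤ)) * (W * V)) ∎

cU : ℕ → ℕ → ℕ → ℤ
cU a b ℓ = binom (a ℕ.+ b) ℓ * binom ℓ a * binom ℓ b

cU-vanishes : ∀ a b {ℓ} → a ℕ.+ b < ℓ → cU a b ℓ ≡ 0ℤ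
cU-vanishes a b {ℓ} a+b<ℓ = cong (λ x → x * binom ℓ a * binom ℓ b) (binom-vanishes a+b<ℓ)

-- Only the factor j + 1 is cleared: it never vanishes, whereas j + 1 − a and j + 1 − b may.
cU-rec : ∀ a b j → + suc b * + suc b * cU a (suc b) (suc j)
                   ≡ (pronic (+ suc j) - pronic (+ b)) * cU a b (suc j) + + suc j * + suc j * cU a b j
cU-rec a b j = ℤₚ.*-cancelˡ-≡ (+ suc j) _ _ (begin
  + suc j * (+ suc b * + suc b * cU a (suc b) (suc j))
    ≡⟨ cong (λ x → + suc j * (+ suc b * + suc b * (x * binom (suc j) a * binom (suc j) (suc b))))
            (cong (λ n → binom n (suc j)) (ℕₚ.+-suc a b)) ⟩
  + suc j * (+ suc b * + suc b * (binom (suc n) (suc j) * binom (suc j) a * binom (suc j) (suc b)))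
    ≡⟨ cleared (+ a) (+ b) (+ j) (binom (suc n) (suc j)) (binom (suc j) (suc b)) (binom n (suc j)) (binom (suc j) b)
            (binom n j) (binom (suc j) a) (binom j a) (binom j b)
            (binom-absorb n j) (binom-absorb j b) (binom-sucʳ n j) (binom-sucˡ j b) (binom-sucˡ j a) ⟩
  + suc j * ((pronic (+ suc j) - pronic (+ b)) * cU a b (suc j) + + suc j * + suc j * cU a b j) ∎)
  where
  n = a ℕ.+ b
  cleared : ∀ a b j P R P′ R′ x y y′ z →
            P * (1ℤ + j) ≡ (1ℤ + (a + b)) * x →
            R * (1ℤ + b) ≡ (1ℤ + j) * z →
            P′ * (1ℤ + j) ≡ x * (a + b - j) →
            R′ * (1ℤ + j - b) ≡ (1ℤ + j) * z →
            y * (1ℤ + j - a) ≡ (1ℤ + j) * y′ →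
            (1ℤ + j) * ((1ℤ + b) * (1ℤ + b) * (P * y * R))
              ≡ (1ℤ + j) * (((1ℤ + j) * (1ℤ + j + 1ℤ) - b * (b + 1ℤ)) * (P′ * y * R′)
                            + (1ℤ + j) * (1ℤ + j) * (x * y′ * z))
  cleared a b j P R P′ R′ x y y′ z hP hR hP′ hR′ hy = begin
    (1ℤ + j) * ((1ℤ + b) * (1ℤ + b) * (P * y * R))
      ≡⟨ solve (b ∷ j ∷ P ∷ R ∷ y ∷ []) ⟩
    (1ℤ + b) * (P * (1ℤ + j)) * y * (R * (1ℤ + b))
      ≡⟨ cong₂ (λ p r → (1ℤ + b) * p * y * r) hP hR ⟩
    (1ℤ + b) * ((1ℤ + (a + b)) * x) * y * ((1ℤ + j) * z)
      ≡⟨ solve (a ∷ b ∷ j ∷ x ∷ y ∷ z ∷ []) ⟩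
    (1ℤ + j + b + 1ℤ) * (x * (a + b - j)) * y * ((1ℤ + j) * z) + (1ℤ + j) * (1ℤ + j) * x * (y * (1ℤ + j - a)) * z
      ≡⟨ cong₂ (λ p r → (1ℤ + j + b + 1ℤ) * p * y * r + (1ℤ + j) * (1ℤ + j) * x * (y * (1ℤ + j - a)) * z)
               (sym hP′) (sym hR′) ⟩
    (1ℤ + j + b + 1ℤ) * (P′ * (1ℤ + j)) * y * (R′ * (1ℤ + j - b)) + (1ℤ + j) * (1ℤ + j) * x * (y * (1ℤ + j - a)) * z
      ≡⟨ cong (λ w → (1ℤ + j + b + 1ℤ) * (P′ * (1ℤ + j)) * y * (R′ * (1ℤ + j - b))
                     + (1ℤ + j) * (1ℤ + j) * x * w * z) hy ⟩
    (1ℤ + j + b + 1ℤ) * (P′ * (1ℤ + j)) * y * (R′ * (1ℤ + j - b)) + (1ℤ + j) * (1ℤ + j) * x * ((1ℤ + j) * y′) * z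
      ≡⟨ solve (b ∷ j ∷ P′ ∷ R′ ∷ x ∷ y ∷ y′ ∷ z ∷ []) ⟩
    (1ℤ + j) * (((1ℤ + j) * (1ℤ + j + 1ℤ) - b * (b + 1ℤ)) * (P′ * y * R′) + (1ℤ + j) * (1ℤ + j) * (x * y′ * z)) ∎

cU-0-vanishes : ∀ a b → cU a (suc b) 0 ≡ 0ℤ
cU-0-vanishes a b = ℤₚ.*-zeroʳ (binom (a ℕ.+ suc b) 0 * binom 0 a)

cU-0-gap : ∀ a b → (pronic 0ℤ - pronic (+ b)) * cU a b 0 ≡ 0ℤ
cU-0-gap a zero    = refl
cU-0-gap a (suc b) = trans (cong ((pronic 0ℤ - pronic (+ suc b)) *_) (cU-0-vanishes a b))
                           (ℤₚ.*-zeroʳ (pronic 0ℤ - pronic (+ suc b)))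

-- Split k(k+1) − b(b+1) = (k(k+1) − ℓ(ℓ+1)) + (ℓ(ℓ+1) − b(b+1)): by U-rec the first part moves the
-- ℓ-th term onto U k (ℓ+1), and cU-rec recombines the two contributions that land on each U k ℓ.
U-product-step : ∀ a b k →
  Σ≤ (a ℕ.+ b) (λ ℓ → (pronic (+ k) - pronic (+ b)) * (cU a b ℓ * U k ℓ))
    ≡ Σ≤ (suc (a ℕ.+ b)) (λ ℓ → + suc b * + suc b * (cU a (suc b) ℓ * U k ℓ))
U-product-step a b k = begin
  Σ≤ n (λ ℓ → (pronic (+ k) - pronic (+ b)) * (cU a b ℓ * U k ℓ))
    ≡⟨ Σ≤-cong n (λ ℓ _ → raise ℓ) ⟩
  Σ≤ n (λ ℓ → cU a b ℓ * (+ suc ℓ * + suc ℓ * U k (suc ℓ)) + d ℓ)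
    ≡⟨ Σ≤-distrib-+ n _ d ⟩
  Σ≤ n (λ ℓ → cU a b ℓ * (+ suc ℓ * + suc ℓ * U k (suc ℓ))) + Σ≤ n d
    ≡⟨ cong (λ s → Σ≤ n (λ ℓ → cU a b ℓ * (+ suc ℓ * + suc ℓ * U k (suc ℓ))) + s) d-shift ⟩
  Σ≤ n (λ ℓ → cU a b ℓ * (+ suc ℓ * + suc ℓ * U k (suc ℓ))) + Σ≤ n (λ ℓ → d (suc ℓ))
    ≡⟨ Σ≤-distrib-+ n _ (λ ℓ → d (suc ℓ)) ⟨
  Σ≤ n (λ ℓ → cU a b ℓ * (+ suc ℓ * + suc ℓ * U k (suc ℓ)) + d (suc ℓ))
    ≡⟨ Σ≤-cong n (λ ℓ _ → collect ℓ) ⟩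
  Σ≤ n (λ ℓ → f (suc ℓ))
    ≡⟨ Σ≤-shift n f₀≡0 ⟨
  Σ≤ (suc n) f ∎
  where
  n = a ℕ.+ b
  d : ℕ → ℤ
  d ℓ = (pronic (+ ℓ) - pronic (+ b)) * (cU a b ℓ * U k ℓ)
  f : ℕ → ℤ
  f ℓ = + suc b * + suc b * (cU a (suc b) ℓ * U k ℓ)
  raise : ∀ ℓ → (pronic (+ k) - pronic (+ b)) * (cU a b ℓ * U k ℓ)
                ≡ cU a b ℓ * (+ suc ℓ * + suc ℓ * U k (suc ℓ)) + d ℓ
  raise ℓ = trans (split (+ k) (+ ℓ) (+ b) (cU a b ℓ) (U k ℓ))
                  (cong (λ u → cU a b ℓ * u + d ℓ) (sym (U-rec k ℓ)))
    where
    split : ∀ K L B c u → (K * (K + 1ℤ) - B * (B + 1ℤ)) * (c * u)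
                          ≡ c * ((K * (K + 1ℤ) - L * (L + 1ℤ)) * u) + (L * (L + 1ℤ) - B * (B + 1ℤ)) * (c * u)
    split K L B c u = solve (K ∷ L ∷ B ∷ c ∷ u ∷ [])
  collect : ∀ ℓ → cU a b ℓ * (+ suc ℓ * + suc ℓ * U k (suc ℓ)) + d (suc ℓ) ≡ f (suc ℓ)
  collect ℓ = trans (regroup (+ suc ℓ * + suc ℓ) (pronic (+ suc ℓ) - pronic (+ b))
                             (cU a b ℓ) (cU a b (suc ℓ)) (U k (suc ℓ)))
                    (trans (cong (_* U k (suc ℓ)) (sym (cU-rec a b ℓ)))
                           (ℤₚ.*-assoc (+ suc b * + suc b) (cU a (suc b) (suc ℓ)) (U k (suc ℓ))))
    where
    regroup : ∀ s g c c′ u → c * (s * u) + g * (c′ * u) ≡ (g * c′ + s * c) * u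
    regroup s g c c′ u = solve (s ∷ g ∷ c ∷ c′ ∷ u ∷ [])
  f₀≡0 : f 0 ≡ 0ℤ
  f₀≡0 = trans (cong (λ c → + suc b * + suc b * (c * U k 0)) (cU-0-vanishes a b)) (ℤₚ.*-zeroʳ (+ suc b * + suc b))
  d-shift : Σ≤ n d ≡ Σ≤ n (λ ℓ → d (suc ℓ))
  d-shift = begin
    Σ≤ n d                          ≡⟨ Σ≤-extend (suc n) (ℕₚ.n≤1+n n) d-vanishes ⟨
    Σ≤ (suc n) d                    ≡⟨ Σ≤-shift n d₀≡0 ⟩
    Σ≤ n (λ ℓ → d (suc ℓ))          ∎
    where
    d-vanishes : ∀ ℓ → n < ℓ → ℓ ≤ suc n → d ℓ ≡ 0ℤ
    d-vanishes ℓ n<ℓ _ = trans (cong (λ c → (pronic (+ ℓ) - pronic (+ b)) * (c * U k ℓ)) (cU-vanishes a b n<ℓ))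
                               (ℤₚ.*-zeroʳ (pronic (+ ℓ) - pronic (+ b)))
    d₀≡0 : d 0 ≡ 0ℤ
    d₀≡0 = trans (sym (ℤₚ.*-assoc (pronic 0ℤ - pronic (+ b)) (cU a b 0) (U k 0))) (cong (_* U k 0) (cU-0-gap a b))

U-product : ∀ a b k → U k a * U k b ≡ Σ≤ (a ℕ.+ b) (λ ℓ → cU a b ℓ * U k ℓ)
U-product a zero k = sym (begin
  Σ≤ (a ℕ.+ 0) (λ ℓ → cU a 0 ℓ * U k ℓ) ≡⟨ Σ≤-single a (ℕₚ.m≤m+n a 0) off-diagonal ⟩
  cU a 0 a * U k a                       ≡⟨ cong (_* U k a) diagonal ⟩
  1ℤ * U k a                             ≡⟨ ℤₚ.*-identityˡ (U k a) ⟩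
  U k a                                  ≡⟨ ℤₚ.*-identityʳ (U k a) ⟨
  U k a * U k 0                          ∎)
  where
  diagonal : cU a 0 a ≡ 1ℤ
  diagonal = cong₂ (λ x y → x * y * 1ℤ) (trans (cong (λ m → binom m a) (ℕₚ.+-identityʳ a)) (binom-diagonal a))
                                        (binom-diagonal a)
  off-diagonal : ∀ j → j ≤ a ℕ.+ 0 → j ≢ a → cU a 0 j * U k j ≡ 0ℤ
  off-diagonal j _ j≢a with ℕₚ.<-cmp j a
  ... | tri< j<a _ _ = cong (λ c → c * binom j 0 * U k j)
                            (trans (cong (binom (a ℕ.+ 0) j *_) (binom-vanishes j<a)) (ℤₚ.*-zeroʳ (binom (a ℕ.+ 0) j)))
  ... | tri≈ _ j≡a _ = contradiction j≡a j≢a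
  ... | tri> _ _ a<j = cong (λ c → c * binom j a * binom j 0 * U k j)
                            (binom-vanishes (subst (_< j) (sym (ℕₚ.+-identityʳ a)) a<j))
U-product a (suc b) k = ℤₚ.*-cancelˡ-≡ (+ suc b * + suc b) _ _ (begin
  + suc b * + suc b * (U k a * U k (suc b))      ≡⟨ x∙yz≈y∙xz (+ suc b * + suc b) (U k a) (U k (suc b)) ⟩
  U k a * (+ suc b * + suc b * U k (suc b))      ≡⟨ cong (U k a *_) (U-rec k b) ⟩
  U k a * (g * U k b)                            ≡⟨ x∙yz≈y∙xz (U k a) g (U k b) ⟩
  g * (U k a * U k b)                            ≡⟨ cong (g *_) (U-product a b k) ⟩
  g * Σ≤ (a ℕ.+ b) (λ ℓ → cU a b ℓ * U k ℓ)      ≡⟨ Σ≤-*ˡ (a ℕ.+ b) g (λ ℓ → cU a b ℓ * U k ℓ) ⟨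
  Σ≤ (a ℕ.+ b) (λ ℓ → g * (cU a b ℓ * U k ℓ))    ≡⟨ U-product-step a b k ⟩
  Σ≤ (suc (a ℕ.+ b)) (λ ℓ → + suc b * + suc b * (cU a (suc b) ℓ * U k ℓ))
    ≡⟨ Σ≤-*ˡ (suc (a ℕ.+ b)) (+ suc b * + suc b) (λ ℓ → cU a (suc b) ℓ * U k ℓ) ⟩
  + suc b * + suc b * Σ≤ (suc (a ℕ.+ b)) (λ ℓ → cU a (suc b) ℓ * U k ℓ)
    ≡⟨ cong (λ n → + suc b * + suc b * Σ≤ n (λ ℓ → cU a (suc b) ℓ * U k ℓ)) (ℕₚ.+-suc a b) ⟨
  + suc b * + suc b * Σ≤ (a ℕ.+ suc b) (λ ℓ → cU a (suc b) ℓ * U k ℓ) ∎)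
  where
  g = pronic (+ k) - pronic (+ b)

-- With g_c = C(ℓ,c) and s_c = C(ℓ+1,c+1) = (ℓ+1)·g_c/(c+1), cT equals
-- C(a+b,ℓ)·g_a·g_b·(ℓ+1)·(1/(b+1) + 1/(a+1) − (a+b+1)/((a+1)(b+1))), and the bracket is 1/((a+1)(b+1)).
cT : ℕ → ℕ → ℕ → ℤ
cT a b ℓ = binom (a ℕ.+ b) ℓ * (binom ℓ a * binom (suc ℓ) (suc b) + binom ℓ b * binom (suc ℓ) (suc a))
           - binom (suc (a ℕ.+ b)) (suc ℓ) * binom (suc ℓ) (suc a) * binom (suc ℓ) (suc b)

cT-vanishes : ∀ a b {ℓ} → a ℕ.+ b < ℓ → cT a b ℓ ≡ 0ℤ
cT-vanishes a b {ℓ} a+b<ℓ =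
  cong₂ (λ x z → x * (binom ℓ a * binom (suc ℓ) (suc b) + binom ℓ b * binom (suc ℓ) (suc a))
                 - z * binom (suc ℓ) (suc a) * binom (suc ℓ) (suc b))
        (binom-vanishes a+b<ℓ) (binom-vanishes (s≤s a+b<ℓ))

[1+a]*[1+b]*cT≡cU*[1+ℓ] : ∀ a b ℓ → + suc a * + suc b * cT a b ℓ ≡ cU a b ℓ * + suc ℓ
[1+a]*[1+b]*cT≡cU*[1+ℓ] a b ℓ =
  cleared (+ a) (+ b) (+ ℓ) (binom (a ℕ.+ b) ℓ) (binom ℓ a) (binom ℓ b)
       (binom (suc ℓ) (suc a)) (binom (suc ℓ) (suc b)) (binom (suc (a ℕ.+ b)) (suc ℓ))
       (binom-absorb ℓ a) (binom-absorb ℓ b) (binom-absorb (a ℕ.+ b) ℓ)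
  where
  cleared : ∀ a b ℓ n gₐ g_b sₐ s_b z →
            sₐ * (1ℤ + a) ≡ (1ℤ + ℓ) * gₐ → s_b * (1ℤ + b) ≡ (1ℤ + ℓ) * g_b →
            z * (1ℤ + ℓ) ≡ (1ℤ + (a + b)) * n →
            (1ℤ + a) * (1ℤ + b) * (n * (gₐ * s_b + g_b * sₐ) - z * sₐ * s_b) ≡ n * gₐ * g_b * (1ℤ + ℓ)
  cleared a b ℓ n gₐ g_b sₐ s_b z hₐ h_b h_z = begin
    (1ℤ + a) * (1ℤ + b) * (n * (gₐ * s_b + g_b * sₐ) - z * sₐ * s_b)
      ≡⟨ solve (a ∷ b ∷ n ∷ gₐ ∷ g_b ∷ sₐ ∷ s_b ∷ z ∷ []) ⟩
    (1ℤ + a) * n * gₐ * (s_b * (1ℤ + b)) + (1ℤ + b) * n * g_b * (sₐ * (1ℤ + a)) - z * (sₐ * (1ℤ + a)) * (s_b * (1ℤ + b))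
      ≡⟨ cong₂ (λ x y → (1ℤ + a) * n * gₐ * y + (1ℤ + b) * n * g_b * x - z * x * y) hₐ h_b ⟩
    (1ℤ + a) * n * gₐ * ((1ℤ + ℓ) * g_b) + (1ℤ + b) * n * g_b * ((1ℤ + ℓ) * gₐ) - z * ((1ℤ + ℓ) * gₐ) * ((1ℤ + ℓ) * g_b)
      ≡⟨ solve (a ∷ b ∷ ℓ ∷ n ∷ gₐ ∷ g_b ∷ z ∷ []) ⟩
    (1ℤ + a) * n * gₐ * ((1ℤ + ℓ) * g_b) + (1ℤ + b) * n * g_b * ((1ℤ + ℓ) * gₐ) - z * (1ℤ + ℓ) * (1ℤ + ℓ) * gₐ * g_b
      ≡⟨ cong (λ x → (1ℤ + a) * n * gₐ * ((1ℤ + ℓ) * g_b) + (1ℤ + b) * n * g_b * ((1ℤ + ℓ) * gₐ)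
                     - x * (1ℤ + ℓ) * gₐ * g_b) h_z ⟩
    (1ℤ + a) * n * gₐ * ((1ℤ + ℓ) * g_b) + (1ℤ + b) * n * g_b * ((1ℤ + ℓ) * gₐ) - (1ℤ + (a + b)) * n * (1ℤ + ℓ) * gₐ * g_b
      ≡⟨ solve (a ∷ b ∷ ℓ ∷ n ∷ gₐ ∷ g_b ∷ []) ⟩
    n * gₐ * g_b * (1ℤ + ℓ) ∎

T-product : ∀ {a b N} → a ℕ.+ b ≤ N → ∀ k → + T k a * + T k b ≡ Σ≤ N (λ ℓ → cT a b ℓ * + T k ℓ)
T-product {a} {b} {N} a+b≤N k = ℤₚ.*-cancelˡ-≡ (+ suc a * + suc b) _ _ (begin
  + suc a * + suc b * (+ T k a * + T k b)
    ≡⟨ *-interchange (+ suc a) (+ suc b) (+ T k a) (+ T k b) ⟩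
  + suc a * + T k a * (+ suc b * + T k b)
    ≡⟨ cong₂ _*_ (U≡[1+ℓ]*T k a) (U≡[1+ℓ]*T k b) ⟨
  U k a * U k b
    ≡⟨ U-product a b k ⟩
  Σ≤ (a ℕ.+ b) (λ ℓ → cU a b ℓ * U k ℓ)
    ≡⟨ Σ≤-cong (a ℕ.+ b) (λ ℓ _ → to-T ℓ) ⟩
  Σ≤ (a ℕ.+ b) (λ ℓ → d * (cT a b ℓ * + T k ℓ))
    ≡⟨ Σ≤-*ˡ (a ℕ.+ b) d (λ ℓ → cT a b ℓ * + T k ℓ) ⟩
  d * Σ≤ (a ℕ.+ b) (λ ℓ → cT a b ℓ * + T k ℓ)
    ≡⟨ cong (d *_) (Σ≤-extend N a+b≤N λ ℓ a+b<ℓ _ → cong (_* + T k ℓ) (cT-vanishes a b a+b<ℓ)) ⟨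
  d * Σ≤ N (λ ℓ → cT a b ℓ * + T k ℓ) ∎)
  where
  d = + suc a * + suc b
  to-T : ∀ ℓ → cU a b ℓ * U k ℓ ≡ d * (cT a b ℓ * + T k ℓ)
  to-T ℓ = begin
    cU a b ℓ * U k ℓ                  ≡⟨ cong (cU a b ℓ *_) (U≡[1+ℓ]*T k ℓ) ⟩
    cU a b ℓ * (+ suc ℓ * + T k ℓ)    ≡⟨ ℤₚ.*-assoc (cU a b ℓ) (+ suc ℓ) (+ T k ℓ) ⟨
    cU a b ℓ * + suc ℓ * + T k ℓ      ≡⟨ cong (_* + T k ℓ) ([1+a]*[1+b]*cT≡cU*[1+ℓ] a b ℓ) ⟨
    d * cT a b ℓ * + T k ℓ            ≡⟨ ℤₚ.*-assoc d (cT a b ℓ) (+ T k ℓ) ⟩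
    d * (cT a b ℓ * + T k ℓ)          ∎

-- Evaluating at k = ℓ kills every T k j with j > ℓ, while the coefficients with j < ℓ vanish by induction.
T-independent : ∀ n {c : ℕ → ℤ} → (∀ k → Σ≤ n (λ ℓ → c ℓ * + T k ℓ) ≡ 0ℤ) →
                ∀ ℓ → ℓ ≤ n → c ℓ ≡ 0ℤ
T-independent n {c} Σ≡0 = <-rec (λ ℓ → ℓ ≤ n → c ℓ ≡ 0ℤ) step
  where
  step : ∀ ℓ → (∀ {j} → j < ℓ → j ≤ n → c j ≡ 0ℤ) → ℓ ≤ n → c ℓ ≡ 0ℤ
  step ℓ below ℓ≤n with ℤₚ.i*j≡0⇒i≡0∨j≡0 (c ℓ) (trans (sym (Σ≤-single ℓ ℓ≤n others)) (Σ≡0 ℓ))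
    where
    others : ∀ j → j ≤ n → j ≢ ℓ → c j * + T ℓ j ≡ 0ℤ
    others j j≤n j≢ℓ with ℕₚ.<-cmp j ℓ
    ... | tri< j<ℓ _ _ = cong (_* + T ℓ j) (below j<ℓ j≤n)
    ... | tri≈ _ j≡ℓ _ = contradiction j≡ℓ j≢ℓ
    ... | tri> _ _ ℓ<j = trans (cong (λ t → c j * + t) (T-vanishes ℓ<j)) (ℤₚ.*-zeroʳ (c j))
  ... | inj₁ cℓ≡0 = cℓ≡0
  ... | inj₂ Tℓℓ≡0 = contradiction (ℤₚ.+-injective Tℓℓ≡0) (T-diagonal≢0 ℓ)

T-coefficients-unique : ∀ n {f g : ℕ → ℤ} →
  (∀ k → Σ≤ n (λ ℓ → f ℓ * + T k ℓ) ≡ Σ≤ n (λ ℓ → g ℓ * + T k ℓ)) → ∀ ℓ → ℓ ≤ n → f ℓ ≡ g ℓ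
T-coefficients-unique n {f} {g} same ℓ ℓ≤n =
  ℤₚ.i-j≡0⇒i≡j (f ℓ) (g ℓ) (T-independent n {λ ℓ → f ℓ - g ℓ} difference ℓ ℓ≤n)
  where
  difference : ∀ k → Σ≤ n (λ ℓ → (f ℓ - g ℓ) * + T k ℓ) ≡ 0ℤ
  difference k = begin
    Σ≤ n (λ ℓ → (f ℓ - g ℓ) * + T k ℓ)
      ≡⟨ Σ≤-cong n (λ ℓ _ → distrib (f ℓ) (g ℓ) (+ T k ℓ)) ⟩
    Σ≤ n (λ ℓ → f ℓ * + T k ℓ - g ℓ * + T k ℓ)
      ≡⟨ Σ≤-distrib-- n (λ ℓ → f ℓ * + T k ℓ) (λ ℓ → g ℓ * + T k ℓ) ⟩
    Σ≤ n (λ ℓ → f ℓ * + T k ℓ) - Σ≤ n (λ ℓ → g ℓ * + T k ℓ)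
      ≡⟨ cong (_- Σ≤ n (λ ℓ → g ℓ * + T k ℓ)) (same k) ⟩
    Σ≤ n (λ ℓ → g ℓ * + T k ℓ) - Σ≤ n (λ ℓ → g ℓ * + T k ℓ)
      ≡⟨ ℤₚ.+-inverseʳ (Σ≤ n (λ ℓ → g ℓ * + T k ℓ)) ⟩
    0ℤ ∎
    where
    distrib : ∀ x y t → (x - y) * t ≡ x * t - y * t
    distrib x y t = trans (ℤₚ.*-distribʳ-+ t x (- y)) (cong (λ z → x * t + z) (sym (ℤₚ.neg-distribˡ-* y t)))

-- Imported only now: overloaded with the list constructors, they make the solver calls above very slow.
open import Data.Vec using ([]; _∷_)

A : ∀ {m} → Vec ℕ m → ℕ → ℤ
A []       zero    = 1ℤ
A []       (suc _) = 0ℤ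
A (i ∷ is) ℓ       = Σ≤ (vsum is) (λ j → A is j * cT i j ℓ)

A-vanishes : ∀ {m} (is : Vec ℕ m) {ℓ} → vsum is < ℓ → A is ℓ ≡ 0ℤ
A-vanishes []       {suc ℓ} _    = refl
A-vanishes (i ∷ is) {ℓ}     i+S<ℓ = Σ≤-zero (vsum is) λ j j≤S →
  trans (cong (A is j *_) (cT-vanishes i j (ℕₚ.≤-<-trans (ℕₚ.+-monoʳ-≤ i j≤S) i+S<ℓ))) (ℤₚ.*-zeroʳ (A is j))

prodT-expansion : ∀ {m} (is : Vec ℕ m) k → + prodT k is ≡ Σ≤ (vsum is) (λ ℓ → A is ℓ * + T k ℓ)
prodT-expansion []       k = refl
prodT-expansion (i ∷ is) k = begin
  + (T k i ℕ.* prodT k is)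
    ≡⟨ ℤₚ.pos-* (T k i) (prodT k is) ⟩
  + T k i * + prodT k is
    ≡⟨ cong (+ T k i *_) (prodT-expansion is k) ⟩
  + T k i * Σ≤ S (λ j → A is j * + T k j)
    ≡⟨ Σ≤-*ˡ S (+ T k i) (λ j → A is j * + T k j) ⟨
  Σ≤ S (λ j → + T k i * (A is j * + T k j))
    ≡⟨ Σ≤-cong S (λ j j≤S → expand j j≤S) ⟩
  Σ≤ S (λ j → Σ≤ (i ℕ.+ S) (λ ℓ → A is j * cT i j ℓ * + T k ℓ))
    ≡⟨ Σ≤-comm S (i ℕ.+ S) (λ j ℓ → A is j * cT i j ℓ * + T k ℓ) ⟩
  Σ≤ (i ℕ.+ S) (λ ℓ → Σ≤ S (λ j → A is j * cT i j ℓ * + T k ℓ))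
    ≡⟨ Σ≤-cong (i ℕ.+ S) (λ ℓ _ → Σ≤-*ʳ S (+ T k ℓ) (λ j → A is j * cT i j ℓ)) ⟩
  Σ≤ (i ℕ.+ S) (λ ℓ → A (i ∷ is) ℓ * + T k ℓ) ∎
  where
  S = vsum is
  expand : ∀ j → j ≤ S → + T k i * (A is j * + T k j) ≡ Σ≤ (i ℕ.+ S) (λ ℓ → A is j * cT i j ℓ * + T k ℓ)
  expand j j≤S = begin
    + T k i * (A is j * + T k j)
      ≡⟨ x∙yz≈y∙xz (+ T k i) (A is j) (+ T k j) ⟩
    A is j * (+ T k i * + T k j)
      ≡⟨ cong (A is j *_) (T-product {i} {j} (ℕₚ.+-monoʳ-≤ i j≤S) k) ⟩
    A is j * Σ≤ (i ℕ.+ S) (λ ℓ → cT i j ℓ * + T k ℓ)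
      ≡⟨ Σ≤-*ˡ (i ℕ.+ S) (A is j) (λ ℓ → cT i j ℓ * + T k ℓ) ⟨
    Σ≤ (i ℕ.+ S) (λ ℓ → A is j * (cT i j ℓ * + T k ℓ))
      ≡⟨ Σ≤-cong (i ℕ.+ S) (λ ℓ _ → ℤₚ.*-assoc (A is j) (cT i j ℓ) (+ T k ℓ)) ⟨
    Σ≤ (i ℕ.+ S) (λ ℓ → A is j * cT i j ℓ * + T k ℓ) ∎

vsum≡sum : ∀ {m} (is : Vec ℕ m) → vsum is ≡ sum (toList is)
vsum≡sum []       = refl
vsum≡sum (i ∷ is) = cong (i ℕ.+_) (vsum≡sum is)

prodT≡product : ∀ {m} k (is : Vec ℕ m) → prodT k is ≡ product (map (T k) (toList is))
prodT≡product k []       = refl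
prodT≡product k (i ∷ is) = cong (T k i ℕ.*_) (prodT≡product k is)

vsum-↭ : ∀ {m n} {is : Vec ℕ m} {js : Vec ℕ n} → toList js ↭ toList is → vsum js ≡ vsum is
vsum-↭ {is = is} {js} js↭is = trans (vsum≡sum js) (trans (sum-↭ js↭is) (sym (vsum≡sum is)))

prodT-↭ : ∀ {m n} {is : Vec ℕ m} {js : Vec ℕ n} → toList js ↭ toList is → ∀ k → prodT k js ≡ prodT k is
prodT-↭ {is = is} {js} js↭is k =
  trans (prodT≡product k js) (trans (product-↭ (↭.map⁺ (T k) js↭is)) (sym (prodT≡product k is)))

A-↭ : ∀ {m n} (is : Vec ℕ m) (js : Vec ℕ n) → toList js ↭ toList is → ∀ ℓ → A js ℓ ≡ A is ℓ
A-↭ is js js↭is ℓ with ℕₚ.≤-<-connex ℓ (vsum is)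
... | inj₁ ℓ≤S = T-coefficients-unique (vsum is) {A js} {A is} same-expansion ℓ ℓ≤S
  where
  same-expansion : ∀ k → Σ≤ (vsum is) (λ ℓ → A js ℓ * + T k ℓ) ≡ Σ≤ (vsum is) (λ ℓ → A is ℓ * + T k ℓ)
  same-expansion k = begin
    Σ≤ (vsum is) (λ ℓ → A js ℓ * + T k ℓ)  ≡⟨ cong (λ n → Σ≤ n (λ ℓ → A js ℓ * + T k ℓ)) (vsum-↭ js↭is) ⟨
    Σ≤ (vsum js) (λ ℓ → A js ℓ * + T k ℓ)  ≡⟨ prodT-expansion js k ⟨
    + prodT k js                           ≡⟨ cong +_ (prodT-↭ js↭is k) ⟩
    + prodT k is                           ≡⟨ prodT-expansion is k ⟩
    Σ≤ (vsum is) (λ ℓ → A is ℓ * + T k ℓ)  ∎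
... | inj₂ S<ℓ = trans (A-vanishes js (subst (_< ℓ) (sym (vsum-↭ js↭is)) S<ℓ)) (sym (A-vanishes is S<ℓ))

lemma3p4 : ∃ λ (A : ∀ {m} → Vec ℕ m → ℕ → ℤ) →
    (∀ (m : ℕ) (is : Vec ℕ (suc m)) (k : ℕ) →
       + prodT k is ≡ Σ≤ (vsum is) (λ ℓ → A is ℓ *ℤ + T k ℓ))
  × (∀ (m : ℕ) (is is′ : Vec ℕ (suc m)) → toList is′ ↭ toList is → ∀ (ℓ : ℕ) → A is′ ℓ ≡ A is ℓ)
lemma3p4 = A , (λ _ is k → prodT-expansion is k) , (λ _ → A-↭)
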